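{- Let $\Gamma$ be a nilpotent group, let $r\ge1$, and for each $j=1,\ldots,r$ let $x^{(j)}_1,\ldots,x^{(j)}_{m_j}$ be elements of $\Gamma$. Suppose that $\alpha$ is a commutator form of weight $r$. Then there exist formal commutators $\eta_1,\ldots,\eta_t$ in the letters $x^{(j)}_i$ with the following properties. (i) In $\Gamma$ we have $\alpha\big(\prod_{i=1}^{m_1}x^{(1)}_i,\ldots,\prod_{i=1}^{m_r}x^{(r)}_i\big)=\eta_1\cdots\eta_t$. (ii) For each tuple $(i_1,\ldots,i_r)$ with $i_j\in[1,m_j]$ there is some $\eta_l$ equal to $\alpha(x^{(1)}_{i_1},\ldots,x^{(r)}_{i_r})$. (iii) For every $l\in[1,t]$ and every $j\in[1,r]$ there is at least one $i\in[1,m_j]$ with $x^{(j)}_i\sqsubset\eta_l$. (iv) The $\eta_l$ are all distinct as formal commutators in the $x^{(j)}_i$. (v) If $\eta_l$ is not of the form $\alpha(x^{(1)}_{i_1},\ldots,x^{(r)}_{i_r})$ then $\eta_l$ has total weight greater than $r$.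
   Context: Formal commutators in letters: each letter is a formal commutator, and if $\alpha,\alpha'$ are formal commutators then so is $[\alpha,\alpha']$; they are interpreted in a group by substituting group elements for letters and $[u,v]=u^{ -1}v^{ -1}uv$. The total weight of a formal commutator is the number of letter occurrences in it (letters have weight 1, $[\alpha,\alpha']$ has weight equal to the sum). The set of components $C(\alpha)$ is defined by $C(x)=\{x\}$ for a letter $x$ and $C([\alpha,\alpha'])=C(\alpha)\cup C(\alpha')\cup\{[\alpha,\alpha']\}$; $\beta\sqsubset\alpha$ means $\beta\in C(\alpha)$. A commutator form of weight 1 is the identity map $y\mapsto y$; a commutator form of weight $n\ge2$ is a map $\gamma$ taking an $n$-tuple $(y_1,\ldots,y_n)$ to a formal commutator, for which there are commutator forms $\gamma_1,\gamma_2$ of weights $m_1+m_2=n$ and a permutation $\sigma\in S_n$ with $\gamma(y_1,\ldots,y_n)=[\gamma_1(y_{\sigma(1)},\ldots,y_{\sigma(m_1)}),\gamma_2(y_{\sigma(m_1+1)},\ldots,y_{\sigma(n)})]$. In (i), $\alpha$ is applied to group elements, the result interpreted in $\Gamma$; the $x^{(j)}_i$ are treated as distinct letters when speaking of formal commutators. -}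

module Defs where

open import Level using (Level; _⊔_)
open import Data.Nat using (ℕ; zero; suc; _+_)
open import Data.Fin using (Fin; zero; suc; _↑ˡ_; _↑ʳ_)
open import Data.Fin.Permutation using (Permutation′; _⟨$⟩ʳ_)
open import Data.Product using (Σ)
open import Algebra.Bundles using (Group)

data FC (A : Set) : Set where
  letter : A → FC A
  ⟦_,_⟧  : FC A → FC A → FC A

weight : ∀ {A} → FC A → ℕ
weight (letter _) = 1
weight ⟦ a , b ⟧ = weight a + weight b

data _⊑_ {A : Set} : FC A → FC A → Set where
  here  : ∀ {α} → α ⊑ α
  left  : ∀ {β α α′} → β ⊑ α  → β ⊑ ⟦ α , α′ ⟧
  right : ∀ {β α α′} → β ⊑ α′ → β ⊑ ⟦ α , α′ ⟧

-- Commutator forms of weight n (syntax): weight 1 is the identity map;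
-- weight m₁+m₂ is y ↦ [γ₁(y_{σ(1)},…,y_{σ(m₁)}), γ₂(y_{σ(m₁+1)},…,y_{σ(n)})]
data CForm : ℕ → Set where
  idF  : CForm 1
  node : ∀ {m₁ m₂} → CForm m₁ → CForm m₂ → Permutation′ (m₁ + m₂) → CForm (m₁ + m₂)

apply : ∀ {n} {B : Set} → CForm n → (Fin n → B) → FC B
apply idF y = letter (y zero)
apply (node {m₁} {m₂} γ₁ γ₂ σ) y =
  ⟦ apply γ₁ (λ i → y (σ ⟨$⟩ʳ (i ↑ˡ m₂))) , apply γ₂ (λ i → y (σ ⟨$⟩ʳ (m₁ ↑ʳ i))) ⟧

module _ {c ℓ : Level} (G : Group c ℓ) where
  open Group G

  comm : Carrier → Carrier → Carrier
  comm u v = u ⁻¹ ∙ v ⁻¹ ∙ u ∙ v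

  evalFC : ∀ {A : Set} → (A → Carrier) → FC A → Carrier
  evalFC v (letter a) = v a
  evalFC v ⟦ a , b ⟧ = comm (evalFC v a) (evalFC v b)

  prod : (k : ℕ) → (Fin k → Carrier) → Carrier
  prod zero g = ε
  prod (suc k) g = g zero ∙ prod k (λ i → g (suc i))

  -- LCS k g  means  g ∈ γ_{k+1}(G)  (lower central series:
  -- γ₁ = G, γ_{k+1} = subgroup generated by [g,h] with g ∈ γ_k, h ∈ G)
  data LCS : ℕ → Carrier → Set (c ⊔ ℓ) where
    top  : ∀ g → LCS zero g
    gen  : ∀ {k g} → LCS k g → ∀ h → LCS (suc k) (comm g h)
    unit : ∀ {k} → LCS (suc k) ε
    mul  : ∀ {k a b} → LCS (suc k) a → LCS (suc k) b → LCS (suc k) (a ∙ b)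
    inv  : ∀ {k a} → LCS (suc k) a → LCS (suc k) (a ⁻¹)
    resp : ∀ {k a b} → a ≈ b → LCS k a → LCS k b

  IsNilpotent : Set (c ⊔ ℓ)
  IsNilpotent = Σ ℕ λ k → ∀ g → LCS k g → g ≈ ε

Letter : (r : ℕ) → (Fin r → ℕ) → Set
Letter r m = Σ (Fin r) λ j → Fin (m j)

-- The expansion is exact in every group.  It rests
-- on the two identities [a, bw] = [a, w] [a, b]^w and [aP, Q] = [a, Q]^P [P, Q],
-- together with t [t, d] = t^d, which rewrites a conjugate as a product of
-- formal commutators.
module Submission where

open import Defs
open import Level using (Level)
open import Function using (_∘_)
open import Function.Definitions using (Injective)
open import Data.Empty using (⊥-elim)
open import Data.Nat using (ℕ; zero; suc; _+_; _≤_; _<_; z≤n; s≤s)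
open import Data.Nat.Properties
  using (≤-refl; ≤-trans; ≤-reflexive; <⇒≤; ≤-<-trans; m≤m+n; m<m+n; +-mono-≤; +-monoˡ-≤; +-mono-<-≤; +-mono-≤-<; module ≤-Reasoning)
open import Data.Fin using (Fin; zero; suc; _↑ˡ_; _↑ʳ_; splitAt; fromℕ<)
open import Data.Fin.Properties using (↑ˡ-injective; ↑ʳ-injective; splitAt-↑ˡ; splitAt-↑ʳ; splitAt⁻¹-↑ˡ; splitAt⁻¹-↑ʳ; any?; _≟_)
open import Data.Fin.Permutation using (Permutation′; _⟨$⟩ʳ_; _⟨$⟩ˡ_)
import Data.Fin.Permutation as Permutation
open import Data.Product using (Σ; ∃; _×_; _,_; proj₁; proj₂)
import Data.Product as Product
open import Data.Sum using (_⊎_; inj₁; inj₂)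
import Data.Sum as Sum
open import Data.List using (List; []; _∷_; _++_; [_]; tabulate; length; lookup)
open import Data.List.Membership.Propositional using (_∈_)
open import Data.List.Membership.Propositional.Properties
  using (∈-++⁺ˡ; ∈-++⁺ʳ; ∈-++⁻; ∈-tabulate⁺; ∈-tabulate⁻; ∈-lookup)
open import Data.List.Relation.Unary.Any using (here; there; index)
open import Data.List.Relation.Unary.Any.Properties using (lookup-index)
open import Data.List.Relation.Unary.All as All using (All; []; _∷_)
import Data.List.Relation.Unary.All.Properties as AllProperties
open import Data.List.Relation.Unary.Unique.Propositional using (Unique; []; _∷_)
import Data.List.Relation.Unary.Unique.Propositional.Properties as UniqueProperties
open import Data.List.Relation.Binary.Disjoint.Propositional using (Disjoint)
open import Relation.Nullary using (¬_; yes; no)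
open import Relation.Binary.PropositionalEquality using (_≡_; _≢_; refl; sym; trans; cong; cong₂; subst)
open import Algebra.Bundles using (Group)
import Algebra.Properties.Group as GroupProperties

module CommutatorIdentities {c ℓ : Level} (G : Group c ℓ) where
  open Group G renaming (sym to ≈-sym; trans to ≈-trans; refl to ≈-refl)
  open GroupProperties G using (ε⁻¹≈ε; inverseʳ-unique; ⁻¹-anti-homo-∙)
  open import Relation.Binary.Reasoning.Setoid setoid

  infixl 9 _^_

  _^_ : Carrier → Carrier → Carrier
  g ^ h = h ⁻¹ ∙ g ∙ h

  ⁅_,_⁆ : Carrier → Carrier → Carrier
  ⁅ u , v ⁆ = comm G u v

  ⁅⁆-cong : ∀ {a b c d} → a ≈ b → c ≈ d → ⁅ a , c ⁆ ≈ ⁅ b , d ⁆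
  ⁅⁆-cong p q = ∙-cong (∙-cong (∙-cong (⁻¹-cong p) (⁻¹-cong q)) p) q

  ^-cong : ∀ {a b c d} → a ≈ b → c ≈ d → a ^ c ≈ b ^ d
  ^-cong p q = ∙-cong (∙-cong (⁻¹-cong q) p) q

  insert-pair : ∀ p y q → p ∙ q ≈ (p ∙ y) ∙ (y ⁻¹ ∙ q)
  insert-pair p y q = begin
    p ∙ q                ≈⟨ ∙-congˡ (≈-sym (identityˡ q)) ⟩
    p ∙ (ε ∙ q)          ≈⟨ ∙-congˡ (∙-congʳ (≈-sym (inverseʳ y))) ⟩
    p ∙ (y ∙ y ⁻¹ ∙ q)   ≈⟨ ∙-congˡ (assoc y (y ⁻¹) q) ⟩
    p ∙ (y ∙ (y ⁻¹ ∙ q)) ≈⟨ ≈-sym (assoc p y _) ⟩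
    p ∙ y ∙ (y ⁻¹ ∙ q)   ∎

  ⁅⁆≈⁻¹∙^ : ∀ u v → ⁅ u , v ⁆ ≈ u ⁻¹ ∙ u ^ v
  ⁅⁆≈⁻¹∙^ u v = ≈-trans (∙-congʳ (assoc (u ⁻¹) (v ⁻¹) u)) (assoc (u ⁻¹) (v ⁻¹ ∙ u) v)

  -- t [t, d] = t^d: conjugating a factor produces a commutator next to it.
  ∙⁅⁆≈^ : ∀ t d → t ∙ ⁅ t , d ⁆ ≈ t ^ d
  ∙⁅⁆≈^ t d = begin
    t ∙ ⁅ t , d ⁆          ≈⟨ ∙-congˡ (⁅⁆≈⁻¹∙^ t d) ⟩
    t ∙ (t ⁻¹ ∙ t ^ d)     ≈⟨ ≈-sym (assoc t (t ⁻¹) _) ⟩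
    t ∙ t ⁻¹ ∙ t ^ d       ≈⟨ ∙-congʳ (inverseʳ t) ⟩
    ε ∙ t ^ d              ≈⟨ identityˡ _ ⟩
    t ^ d                  ∎

  ^-identityʳ : ∀ g → g ^ ε ≈ g
  ^-identityʳ g = ≈-trans (identityʳ _) (≈-trans (∙-congʳ ε⁻¹≈ε) (identityˡ g))

  ^-zeroˡ : ∀ h → ε ^ h ≈ ε
  ^-zeroˡ h = ≈-trans (∙-congʳ (identityʳ _)) (inverseˡ h)

  ⁅⁆-zeroʳ : ∀ a → ⁅ a , ε ⁆ ≈ ε
  ⁅⁆-zeroʳ a = ≈-trans (⁅⁆≈⁻¹∙^ a ε) (≈-trans (∙-congˡ (^-identityʳ a)) (inverseˡ a))

  ⁅⁆-zeroˡ : ∀ q → ⁅ ε , q ⁆ ≈ ε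
  ⁅⁆-zeroˡ q = ≈-trans (⁅⁆≈⁻¹∙^ ε q) (≈-trans (∙-congˡ (^-zeroˡ q)) (inverseˡ ε))

  ^-∙ : ∀ g₁ g₂ h → (g₁ ∙ g₂) ^ h ≈ g₁ ^ h ∙ g₂ ^ h
  ^-∙ g₁ g₂ h = begin
    h ⁻¹ ∙ (g₁ ∙ g₂) ∙ h            ≈⟨ ∙-congʳ (≈-sym (assoc (h ⁻¹) g₁ g₂)) ⟩
    h ⁻¹ ∙ g₁ ∙ g₂ ∙ h              ≈⟨ assoc (h ⁻¹ ∙ g₁) g₂ h ⟩
    h ⁻¹ ∙ g₁ ∙ (g₂ ∙ h)            ≈⟨ insert-pair (h ⁻¹ ∙ g₁) h (g₂ ∙ h) ⟩
    g₁ ^ h ∙ (h ⁻¹ ∙ (g₂ ∙ h))      ≈⟨ ∙-congˡ (≈-sym (assoc (h ⁻¹) g₂ h)) ⟩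
    g₁ ^ h ∙ g₂ ^ h                 ∎

  ^-⁻¹ : ∀ g h → (g ⁻¹) ^ h ≈ (g ^ h) ⁻¹
  ^-⁻¹ g h = inverseʳ-unique (g ^ h) ((g ⁻¹) ^ h) (begin
    g ^ h ∙ (g ⁻¹) ^ h   ≈⟨ ≈-sym (^-∙ g (g ⁻¹) h) ⟩
    (g ∙ g ⁻¹) ^ h       ≈⟨ ^-cong (inverseʳ g) ≈-refl ⟩
    ε ^ h                ≈⟨ ^-zeroˡ h ⟩
    ε                    ∎)

  ^-action : ∀ g h k → g ^ (h ∙ k) ≈ g ^ h ^ k
  ^-action g h k = begin
    (h ∙ k) ⁻¹ ∙ g ∙ (h ∙ k)             ≈⟨ ∙-congʳ (∙-congʳ (⁻¹-anti-homo-∙ h k)) ⟩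
    k ⁻¹ ∙ h ⁻¹ ∙ g ∙ (h ∙ k)            ≈⟨ ≈-sym (assoc _ h k) ⟩
    k ⁻¹ ∙ h ⁻¹ ∙ g ∙ h ∙ k              ≈⟨ ∙-congʳ (∙-congʳ (assoc (k ⁻¹) (h ⁻¹) g)) ⟩
    k ⁻¹ ∙ (h ⁻¹ ∙ g) ∙ h ∙ k            ≈⟨ ∙-congʳ (assoc (k ⁻¹) (h ⁻¹ ∙ g) h) ⟩
    g ^ h ^ k                            ∎

  ⁅⁆-∙ʳ : ∀ a b w → ⁅ a , b ∙ w ⁆ ≈ ⁅ a , w ⁆ ∙ ⁅ a , b ⁆ ^ w
  ⁅⁆-∙ʳ a b w = begin
    ⁅ a , b ∙ w ⁆                             ≈⟨ ⁅⁆≈⁻¹∙^ a (b ∙ w) ⟩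
    a ⁻¹ ∙ a ^ (b ∙ w)                        ≈⟨ ∙-congˡ (^-action a b w) ⟩
    a ⁻¹ ∙ a ^ b ^ w                          ≈⟨ insert-pair (a ⁻¹) (a ^ w) _ ⟩
    a ⁻¹ ∙ a ^ w ∙ ((a ^ w) ⁻¹ ∙ a ^ b ^ w)   ≈⟨ ∙-cong (≈-sym (⁅⁆≈⁻¹∙^ a w)) (∙-congʳ (≈-sym (^-⁻¹ a w))) ⟩
    ⁅ a , w ⁆ ∙ ((a ⁻¹) ^ w ∙ a ^ b ^ w)      ≈⟨ ∙-congˡ (≈-sym (^-∙ (a ⁻¹) (a ^ b) w)) ⟩
    ⁅ a , w ⁆ ∙ (a ⁻¹ ∙ a ^ b) ^ w            ≈⟨ ∙-congˡ (^-cong (≈-sym (⁅⁆≈⁻¹∙^ a b)) ≈-refl) ⟩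
    ⁅ a , w ⁆ ∙ ⁅ a , b ⁆ ^ w                 ∎

  ⁅⁆-∙ˡ : ∀ a P Q → ⁅ a ∙ P , Q ⁆ ≈ ⁅ a , Q ⁆ ^ P ∙ ⁅ P , Q ⁆
  ⁅⁆-∙ˡ a P Q = begin
    ⁅ a ∙ P , Q ⁆                          ≈⟨ ⁅⁆≈⁻¹∙^ (a ∙ P) Q ⟩
    (a ∙ P) ⁻¹ ∙ (a ∙ P) ^ Q               ≈⟨ ∙-cong (⁻¹-anti-homo-∙ a P) (^-∙ a P Q) ⟩
    P ⁻¹ ∙ a ⁻¹ ∙ (a ^ Q ∙ P ^ Q)          ≈⟨ ≈-sym (assoc _ (a ^ Q) (P ^ Q)) ⟩
    P ⁻¹ ∙ a ⁻¹ ∙ a ^ Q ∙ P ^ Q            ≈⟨ ∙-congʳ (assoc (P ⁻¹) (a ⁻¹) (a ^ Q)) ⟩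
    P ⁻¹ ∙ (a ⁻¹ ∙ a ^ Q) ∙ P ^ Q          ≈⟨ ∙-congʳ (∙-congˡ (≈-sym (⁅⁆≈⁻¹∙^ a Q))) ⟩
    P ⁻¹ ∙ ⁅ a , Q ⁆ ∙ P ^ Q               ≈⟨ insert-pair (P ⁻¹ ∙ ⁅ a , Q ⁆) P (P ^ Q) ⟩
    ⁅ a , Q ⁆ ^ P ∙ (P ⁻¹ ∙ P ^ Q)         ≈⟨ ∙-congˡ (≈-sym (⁅⁆≈⁻¹∙^ P Q)) ⟩
    ⁅ a , Q ⁆ ^ P ∙ ⁅ P , Q ⁆              ∎

module _ {L : Set} where

  ⊑-trans : {α β γ : FC L} → α ⊑ β → β ⊑ γ → α ⊑ γ
  ⊑-trans p here      = p
  ⊑-trans p (left q)  = left (⊑-trans p q)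
  ⊑-trans p (right q) = right (⊑-trans p q)

  letter-⊑-⟦⟧ : ∀ {z : L} {α β} → letter z ⊑ ⟦ α , β ⟧ → letter z ⊑ α ⊎ letter z ⊑ β
  letter-⊑-⟦⟧ (left p)  = inj₁ p
  letter-⊑-⟦⟧ (right p) = inj₂ p

  letter-⊑-letter : ∀ {z z′ : L} → letter z ⊑ letter z′ → z ≡ z′
  letter-⊑-letter here = refl

  ⟦⟧-injectiveˡ : {α β α′ β′ : FC L} → ⟦ α , β ⟧ ≡ ⟦ α′ , β′ ⟧ → α ≡ α′
  ⟦⟧-injectiveˡ refl = refl

  ⟦⟧-injectiveʳ : {α β α′ β′ : FC L} → ⟦ α , β ⟧ ≡ ⟦ α′ , β′ ⟧ → β ≡ β′
  ⟦⟧-injectiveʳ refl = refl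

  weight-positive : (α : FC L) → 1 ≤ weight α
  weight-positive (letter _) = s≤s z≤n
  weight-positive ⟦ α , β ⟧ = ≤-trans (weight-positive α) (m≤m+n _ _)

  Mentions : (L → Set) → FC L → Set
  Mentions Q e = ∃ λ z → Q z × letter z ⊑ e

  mentions-⊑ : ∀ {Q} {α β : FC L} → α ⊑ β → Mentions Q α → Mentions Q β
  mentions-⊑ α⊑β (z , q , z⊑α) = z , q , ⊑-trans z⊑α α⊑β

module CommutatorLists {L : Set} where

  nest : FC L → List (FC L) → FC L
  nest t []      = t
  nest t (s ∷ S) = ⟦ nest t S , s ⟧

  nest-++ : ∀ t S₁ S₂ → nest (nest t S₂) S₁ ≡ nest t (S₁ ++ S₂)
  nest-++ t []       S₂ = refl
  nest-++ t (s ∷ S₁) S₂ = cong (λ u → ⟦ u , s ⟧) (nest-++ t S₁ S₂)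

  ⊑-nest : ∀ t S → t ⊑ nest t S
  ⊑-nest t []      = here
  ⊑-nest t (s ∷ S) = left (⊑-nest t S)

  weight-nest : ∀ t S → weight t ≤ weight (nest t S)
  weight-nest t []      = ≤-refl
  weight-nest t (s ∷ S) = ≤-trans (weight-nest t S) (m≤m+n _ _)

  letter-⊑-nest : ∀ {z} t S → letter z ⊑ nest t S → letter z ⊑ t ⊎ ∃ λ s → s ∈ S × letter z ⊑ s
  letter-⊑-nest t [] p = inj₁ p
  letter-⊑-nest t (s ∷ S) p with letter-⊑-⟦⟧ p
  ... | inj₂ q = inj₂ (s , here refl , q)
  ... | inj₁ q with letter-⊑-nest t S q
  ...   | inj₁ q′ = inj₁ q′
  ...   | inj₂ (s′ , s′∈S , q′) = inj₂ (s′ , there s′∈S , q′)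

  Nested : FC L → (FC L → Set) → FC L → Set
  Nested t P e = Σ (List (FC L)) λ S → All P S × e ≡ nest t S

  nested-refl : ∀ {t P} → Nested t P t
  nested-refl = [] , [] , refl

  nested-trans : ∀ {t u e P} → Nested t P u → Nested u P e → Nested t P e
  nested-trans {t} (S₁ , P₁ , refl) (S₂ , P₂ , refl) = S₂ ++ S₁ , AllProperties.++⁺ P₂ P₁ , nest-++ t S₂ S₁

  nested-weaken : ∀ {t e} {P Q : FC L → Set} → (∀ {s} → P s → Q s) → Nested t P e → Nested t Q e
  nested-weaken f (S , PS , eq) = S , All.map f PS , eq

  -- conjugate T c = t₁, [t₁, c], t₂, [t₂, c], …   (product: (Π T)^c)
  conjugate : List (FC L) → FC L → List (FC L)
  conjugate []      c = []
  conjugate (t ∷ T) c = t ∷ ⟦ t , c ⟧ ∷ conjugate T c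

  -- conjugateBy T [c₁, …, cₖ]  (product: (Π T)^(c₁ ⋯ cₖ))
  conjugateBy : List (FC L) → List (FC L) → List (FC L)
  conjugateBy T []      = T
  conjugateBy T (c ∷ C) = conjugateBy (conjugate T c) C

  -- commWith a B  (product: [a, Π B])
  commWith : FC L → List (FC L) → List (FC L)
  commWith a []      = []
  commWith a (b ∷ B) = commWith a B ++ conjugateBy [ ⟦ a , b ⟧ ] B

  -- commList A B  (product: [Π A, Π B])
  commList : List (FC L) → List (FC L) → List (FC L)
  commList []      B = []
  commList (a ∷ A) B = conjugateBy (commWith a B) A ++ commList A B

  mem-conjugate : ∀ {e} T c → e ∈ conjugate T c → e ∈ T ⊎ ∃ λ t → t ∈ T × e ≡ ⟦ t , c ⟧
  mem-conjugate (t ∷ T) c (here p)         = inj₁ (here p)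
  mem-conjugate (t ∷ T) c (there (here p)) = inj₂ (t , here refl , p)
  mem-conjugate (t ∷ T) c (there (there e∈)) with mem-conjugate T c e∈
  ... | inj₁ e∈T            = inj₁ (there e∈T)
  ... | inj₂ (t′ , t′∈T , p) = inj₂ (t′ , there t′∈T , p)

  mem-conjugateBy : ∀ {e} T C → e ∈ conjugateBy T C → ∃ λ t → t ∈ T × Nested t (_∈ C) e
  mem-conjugateBy T []      e∈ = _ , e∈ , nested-refl
  mem-conjugateBy T (c ∷ C) e∈ with mem-conjugateBy (conjugate T c) C e∈
  ... | u , u∈ , u⇝e with mem-conjugate T c u∈
  ...   | inj₁ u∈T             = u , u∈T , nested-weaken there u⇝e
  ...   | inj₂ (t , t∈T , refl) = t , t∈T , nested-trans ([ c ] , here refl ∷ [] , refl) (nested-weaken there u⇝e)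

  mem-commWith : ∀ {e} a B → e ∈ commWith a B → ∃ λ b → b ∈ B × Nested ⟦ a , b ⟧ (_∈ B) e
  mem-commWith a (b ∷ B) e∈ with ∈-++⁻ (commWith a B) e∈
  ... | inj₁ e∈′ with mem-commWith a B e∈′
  ...   | b′ , b′∈B , ab′⇝e = b′ , there b′∈B , nested-weaken there ab′⇝e
  mem-commWith a (b ∷ B) e∈ | inj₂ e∈′ with mem-conjugateBy [ ⟦ a , b ⟧ ] B e∈′
  ...   | _ , here refl , ab⇝e = b , here refl , nested-weaken there ab⇝e

  mem-conjugateBy-commWith : ∀ {e} a A B → e ∈ conjugateBy (commWith a B) A →
    ∃ λ b → b ∈ B × Nested ⟦ a , b ⟧ (λ s → s ∈ A ⊎ s ∈ B) e
  mem-conjugateBy-commWith a A B e∈ with mem-conjugateBy (commWith a B) A e∈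
  ... | u , u∈ , u⇝e with mem-commWith a B u∈
  ...   | b , b∈B , ab⇝u = b , b∈B , nested-trans (nested-weaken inj₂ ab⇝u) (nested-weaken inj₁ u⇝e)

  mem-commList : ∀ {e} A B → e ∈ commList A B →
    ∃ λ a → a ∈ A × ∃ λ b → b ∈ B × Nested ⟦ a , b ⟧ (λ s → s ∈ A ⊎ s ∈ B) e
  mem-commList (a ∷ A) B e∈ with ∈-++⁻ (conjugateBy (commWith a B) A) e∈
  ... | inj₁ e∈′ with mem-conjugateBy-commWith a A B e∈′
  ...   | b , b∈B , ab⇝e = a , here refl , b , b∈B , nested-weaken (Sum.map₁ there) ab⇝e
  mem-commList (a ∷ A) B e∈ | inj₂ e∈′ with mem-commList A B e∈′
  ...   | a′ , a′∈A , b , b∈B , ab⇝e = a′ , there a′∈A , b , b∈B , nested-weaken (Sum.map₁ there) ab⇝e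

  conjugate-keeps : ∀ {t} T c → t ∈ T → t ∈ conjugate T c
  conjugate-keeps (_ ∷ T) c (here p)  = here p
  conjugate-keeps (_ ∷ T) c (there t∈) = there (there (conjugate-keeps T c t∈))

  conjugateBy-keeps : ∀ {t} T C → t ∈ T → t ∈ conjugateBy T C
  conjugateBy-keeps T []      t∈ = t∈
  conjugateBy-keeps T (c ∷ C) t∈ = conjugateBy-keeps (conjugate T c) C (conjugate-keeps T c t∈)

  commWith-basic : ∀ {b} a B → b ∈ B → ⟦ a , b ⟧ ∈ commWith a B
  commWith-basic a (b ∷ B) (here refl) = ∈-++⁺ʳ (commWith a B) (conjugateBy-keeps [ ⟦ a , b ⟧ ] B (here refl))
  commWith-basic a (b ∷ B) (there b∈)  = ∈-++⁺ˡ (commWith-basic a B b∈)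

  commList-basic : ∀ {a b} A B → a ∈ A → b ∈ B → ⟦ a , b ⟧ ∈ commList A B
  commList-basic (a ∷ A) B (here refl) b∈ = ∈-++⁺ˡ (conjugateBy-keeps (commWith a B) A (commWith-basic a B b∈))
  commList-basic (a ∷ A) B (there a∈) b∈  = ∈-++⁺ʳ (conjugateBy (commWith a B) A) (commList-basic A B a∈ b∈)

  commList-above : ∀ {e} A B → e ∈ commList A B → ∃ λ a → a ∈ A × ∃ λ b → b ∈ B × ⟦ a , b ⟧ ⊑ e
  commList-above A B e∈ with mem-commList A B e∈
  ... | a , a∈ , b , b∈ , S , _ , refl = a , a∈ , b , b∈ , ⊑-nest _ S

  commList-letters : ∀ {e z} A B → e ∈ commList A B → letter z ⊑ e →
    ∃ λ s → (s ∈ A ⊎ s ∈ B) × letter z ⊑ s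
  commList-letters A B e∈ z⊑e with mem-commList A B e∈
  ... | a , a∈ , b , b∈ , S , S⊆ , refl with letter-⊑-nest _ S z⊑e
  ...   | inj₂ (s , s∈S , z⊑s) = s , All.lookup S⊆ s∈S , z⊑s
  ...   | inj₁ z⊑ab with letter-⊑-⟦⟧ z⊑ab
  ...     | inj₁ z⊑a = a , inj₁ a∈ , z⊑a
  ...     | inj₂ z⊑b = b , inj₂ b∈ , z⊑b

  commList-weight : ∀ {e} A B → e ∈ commList A B →
    ∃ λ a → a ∈ A × ∃ λ b → b ∈ B × (e ≡ ⟦ a , b ⟧ ⊎ weight a + weight b < weight e)
  commList-weight A B e∈ with mem-commList A B e∈
  ... | a , a∈ , b , b∈ , [] , _ , refl = a , a∈ , b , b∈ , inj₁ refl
  ... | a , a∈ , b , b∈ , s ∷ S , _ , refl = a , a∈ , b , b∈ , inj₂ (begin-strict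
    weight a + weight b                   <⟨ m<m+n _ (weight-positive s) ⟩
    weight a + weight b + weight s        ≤⟨ +-monoˡ-≤ (weight s) (weight-nest ⟦ a , b ⟧ S) ⟩
    weight (nest ⟦ a , b ⟧ S) + weight s  ∎)
    where open ≤-Reasoning

  -- Distinctness.  Fresh T C: no member of T has the shape [u, c] with c ∈ C,
  -- so the commutators with C created by conjugateBy are new.
  Fresh : List (FC L) → List (FC L) → Set
  Fresh T C = ∀ {t u c} → t ∈ T → c ∈ C → t ≢ ⟦ u , c ⟧

  unique-conjugate : ∀ T c → Unique T → (∀ {t u} → t ∈ T → t ≢ ⟦ u , c ⟧) → Unique (conjugate T c)
  unique-conjugate []      c []       fresh = []
  unique-conjugate (t ∷ T) c (t∉T ∷ T!) fresh =
      All.tabulate t-new ∷ All.tabulate tc-new ∷ unique-conjugate T c T! (fresh ∘ there)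
    where
    t-new : ∀ {e} → e ∈ ⟦ t , c ⟧ ∷ conjugate T c → t ≢ e
    t-new (here refl) = fresh (here refl)
    t-new (there e∈) with mem-conjugate T c e∈
    ... | inj₁ e∈T               = All.lookup t∉T e∈T
    ... | inj₂ (t′ , t′∈T , refl) = fresh (here refl)
    tc-new : ∀ {e} → e ∈ conjugate T c → ⟦ t , c ⟧ ≢ e
    tc-new e∈ with mem-conjugate T c e∈
    ... | inj₁ e∈T               = λ eq → fresh (there e∈T) (sym eq)
    ... | inj₂ (t′ , t′∈T , refl) = λ eq → All.lookup t∉T t′∈T (⟦⟧-injectiveˡ eq)

  unique-conjugateBy : ∀ T C → Unique T → Unique C → Fresh T C → Unique (conjugateBy T C)
  unique-conjugateBy T []      T! C!         fresh = T!
  unique-conjugateBy T (c ∷ C) T! (c∉C ∷ C!) fresh =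
      unique-conjugateBy (conjugate T c) C (unique-conjugate T c T! (λ t∈ → fresh t∈ (here refl))) C! fresh′
    where
    fresh′ : Fresh (conjugate T c) C
    fresh′ t∈ c′∈C with mem-conjugate T c t∈
    ... | inj₁ t∈T              = fresh t∈T (there c′∈C)
    ... | inj₂ (_ , _ , refl) = λ eq → All.lookup c∉C c′∈C (⟦⟧-injectiveʳ eq)

  -- Distinctness of commList A B when the members of B are recognisable:
  -- they all satisfy an upward closed property P that no member of A has
  -- (in the application: mentioning a letter from the slots of B).
  -- Then a nest over [a, b] determines a and b.
  module Separated (P : FC L → Set) (P-up : ∀ {α β} → α ⊑ β → P α → P β) where

    nest-determines : ∀ {a b a′ b′} S S′ → ¬ P a → ¬ P a′ → P b → P b′ →
                      nest ⟦ a , b ⟧ S ≡ nest ⟦ a′ , b′ ⟧ S′ → a ≡ a′ × b ≡ b′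
    nest-determines []      []        _  _   _  _   refl = refl , refl
    nest-determines (s ∷ S) (s′ ∷ S′) ¬a ¬a′ pb pb′ eq   = nest-determines S S′ ¬a ¬a′ pb pb′ (⟦⟧-injectiveˡ eq)
    nest-determines []      (s′ ∷ S′) ¬a _   _  pb′ eq   =
      ⊥-elim (¬a (subst P (sym (⟦⟧-injectiveˡ eq)) (P-up (⊑-nest _ S′) (P-up (right here) pb′))))
    nest-determines (s ∷ S) []        _  ¬a′ pb _   eq   =
      ⊥-elim (¬a′ (subst P (⟦⟧-injectiveˡ eq) (P-up (⊑-nest _ S) (P-up (right here) pb))))

    unique-commWith : ∀ a B → ¬ P a → Unique B → All P B → Unique (commWith a B)
    unique-commWith a []      ¬a B! PB = []
    unique-commWith a (b ∷ B) ¬a (b∉B ∷ B!) (pb ∷ PB) =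
        UniqueProperties.++⁺ (unique-commWith a B ¬a B! PB)
                             (unique-conjugateBy [ ⟦ a , b ⟧ ] B ([] ∷ []) B! fresh) disjoint
      where
      fresh : Fresh [ ⟦ a , b ⟧ ] B
      fresh (here refl) c∈B eq = All.lookup b∉B c∈B (⟦⟧-injectiveʳ eq)
      disjoint : Disjoint (commWith a B) (conjugateBy [ ⟦ a , b ⟧ ] B)
      disjoint (e∈₁ , e∈₂) with mem-commWith a B e∈₁ | mem-conjugateBy [ ⟦ a , b ⟧ ] B e∈₂
      ... | b₁ , b₁∈B , S , _ , eq₁ | _ , here refl , S′ , _ , eq₂ =
        All.lookup b∉B b₁∈B (sym (proj₂ (nest-determines S S′ ¬a ¬a (All.lookup PB b₁∈B) pb (trans (sym eq₁) eq₂))))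

    unique-commList : ∀ A B → Unique A → Unique B → All (¬_ ∘ P) A → All P B → Unique (commList A B)
    unique-commList []      B A!         B! ¬PA        PB = []
    unique-commList (a ∷ A) B (a∉A ∷ A!) B! (¬a ∷ ¬PA) PB =
        UniqueProperties.++⁺ (unique-conjugateBy (commWith a B) A (unique-commWith a B ¬a B! PB) A! fresh)
                             (unique-commList A B A! B! ¬PA PB) disjoint
      where
      fresh : Fresh (commWith a B) A
      fresh t∈ c∈A eq with mem-commWith a B t∈
      ... | b , b∈B , []    , _        , eq′ = All.lookup ¬PA c∈A (subst P (⟦⟧-injectiveʳ (trans (sym eq′) eq)) (All.lookup PB b∈B))
      ... | b , b∈B , s ∷ S , s∈B ∷ _  , eq′ = All.lookup ¬PA c∈A (subst P (⟦⟧-injectiveʳ (trans (sym eq′) eq)) (All.lookup PB s∈B))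
      disjoint : Disjoint (conjugateBy (commWith a B) A) (commList A B)
      disjoint (e∈₁ , e∈₂) with mem-conjugateBy-commWith a A B e∈₁ | mem-commList A B e∈₂
      ... | b , b∈B , S , _ , eq₁ | a′ , a′∈A , b′ , b′∈B , S′ , _ , eq₂ =
        All.lookup a∉A a′∈A (proj₁ (nest-determines S S′ ¬a (All.lookup ¬PA a′∈A)
                                      (All.lookup PB b∈B) (All.lookup PB b′∈B) (trans (sym eq₁) eq₂)))

module Evaluation {c ℓ : Level} (G : Group c ℓ) {L : Set} (v : L → Group.Carrier G) where
  open Group G renaming (sym to ≈-sym; trans to ≈-trans; refl to ≈-refl)
  open CommutatorIdentities G
  open CommutatorLists {L}
  open import Relation.Binary.Reasoning.Setoid setoid

  ev : FC L → Carrier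
  ev = evalFC G v

  Π : List (FC L) → Carrier
  Π []       = ε
  Π (e ∷ es) = ev e ∙ Π es

  Π-++ : ∀ xs ys → Π (xs ++ ys) ≈ Π xs ∙ Π ys
  Π-++ []       ys = ≈-sym (identityˡ _)
  Π-++ (x ∷ xs) ys = ≈-trans (∙-congˡ (Π-++ xs ys)) (≈-sym (assoc _ _ _))

  Π-conjugate : ∀ T c → Π (conjugate T c) ≈ Π T ^ ev c
  Π-conjugate []      c = ≈-sym (^-zeroˡ _)
  Π-conjugate (t ∷ T) c = begin
    ev t ∙ (⁅ ev t , ev c ⁆ ∙ Π (conjugate T c)) ≈⟨ ≈-sym (assoc _ _ _) ⟩
    ev t ∙ ⁅ ev t , ev c ⁆ ∙ Π (conjugate T c)   ≈⟨ ∙-cong (∙⁅⁆≈^ _ _) (Π-conjugate T c) ⟩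
    ev t ^ ev c ∙ Π T ^ ev c                      ≈⟨ ≈-sym (^-∙ _ _ _) ⟩
    (ev t ∙ Π T) ^ ev c                           ∎

  Π-conjugateBy : ∀ T C → Π (conjugateBy T C) ≈ Π T ^ Π C
  Π-conjugateBy T []      = ≈-sym (^-identityʳ _)
  Π-conjugateBy T (c ∷ C) = begin
    Π (conjugateBy (conjugate T c) C) ≈⟨ Π-conjugateBy (conjugate T c) C ⟩
    Π (conjugate T c) ^ Π C           ≈⟨ ^-cong (Π-conjugate T c) ≈-refl ⟩
    Π T ^ ev c ^ Π C                  ≈⟨ ≈-sym (^-action _ _ _) ⟩
    Π T ^ (ev c ∙ Π C)                ∎

  Π-commWith : ∀ a B → Π (commWith a B) ≈ ⁅ ev a , Π B ⁆
  Π-commWith a []      = ≈-sym (⁅⁆-zeroʳ _)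
  Π-commWith a (b ∷ B) = begin
    Π (commWith a B ++ conjugateBy [ ⟦ a , b ⟧ ] B)         ≈⟨ Π-++ (commWith a B) _ ⟩
    Π (commWith a B) ∙ Π (conjugateBy [ ⟦ a , b ⟧ ] B)      ≈⟨ ∙-cong (Π-commWith a B) (Π-conjugateBy _ B) ⟩
    ⁅ ev a , Π B ⁆ ∙ (⁅ ev a , ev b ⁆ ∙ ε) ^ Π B            ≈⟨ ∙-congˡ (^-cong (identityʳ _) ≈-refl) ⟩
    ⁅ ev a , Π B ⁆ ∙ ⁅ ev a , ev b ⁆ ^ Π B                  ≈⟨ ≈-sym (⁅⁆-∙ʳ _ _ _) ⟩
    ⁅ ev a , ev b ∙ Π B ⁆                                   ∎

  Π-commList : ∀ A B → Π (commList A B) ≈ ⁅ Π A , Π B ⁆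
  Π-commList []      B = ≈-sym (⁅⁆-zeroˡ _)
  Π-commList (a ∷ A) B = begin
    Π (conjugateBy (commWith a B) A ++ commList A B)        ≈⟨ Π-++ (conjugateBy (commWith a B) A) _ ⟩
    Π (conjugateBy (commWith a B) A) ∙ Π (commList A B)     ≈⟨ ∙-cong (Π-conjugateBy (commWith a B) A) (Π-commList A B) ⟩
    Π (commWith a B) ^ Π A ∙ ⁅ Π A , Π B ⁆                  ≈⟨ ∙-congʳ (^-cong (Π-commWith a B) ≈-refl) ⟩
    ⁅ ev a , Π B ⁆ ^ Π A ∙ ⁅ Π A , Π B ⁆                    ≈⟨ ≈-sym (⁅⁆-∙ˡ _ _ _) ⟩
    ⁅ ev a ∙ Π A , Π B ⁆                                    ∎

  prod-lookup : ∀ xs → prod G (length xs) (λ l → ev (lookup xs l)) ≡ Π xs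
  prod-lookup []       = refl
  prod-lookup (x ∷ xs) = cong (ev x ∙_) (prod-lookup xs)

  prod-tabulate : ∀ k (f : Fin k → FC L) → prod G k (λ i → ev (f i)) ≡ Π (tabulate f)
  prod-tabulate zero    f = refl
  prod-tabulate (suc k) f = cong (ev (f zero) ∙_) (prod-tabulate k (f ∘ suc))

weight-apply : ∀ {n} {B : Set} (γ : CForm n) (y : Fin n → B) → weight (apply γ y) ≡ n
weight-apply idF            y = refl
weight-apply (node γ₁ γ₂ σ) y = cong₂ _+_ (weight-apply γ₁ _) (weight-apply γ₂ _)

apply-cong : ∀ {n} {B : Set} (γ : CForm n) {f g : Fin n → B} → (∀ k → f k ≡ g k) → apply γ f ≡ apply γ g
apply-cong idF            f≗g = cong letter (f≗g zero)
apply-cong (node γ₁ γ₂ σ) f≗g = cong₂ ⟦_,_⟧ (apply-cong γ₁ (λ _ → f≗g _)) (apply-cong γ₂ (λ _ → f≗g _))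

some-slot : ∀ {n} → CForm n → Fin n
some-slot idF                    = zero
some-slot (node {n₁} {n₂} γ₁ _ _) = some-slot γ₁ ↑ˡ n₂

module SlotSplit {n₁ n₂ r : ℕ} (σ : Permutation′ (n₁ + n₂)) (ρ : Fin (n₁ + n₂) → Fin r)
                 (ρ-injective : Injective _≡_ _≡_ ρ) where

  ρ₁ : Fin n₁ → Fin r
  ρ₁ i = ρ (σ ⟨$⟩ʳ (i ↑ˡ n₂))

  ρ₂ : Fin n₂ → Fin r
  ρ₂ i = ρ (σ ⟨$⟩ʳ (n₁ ↑ʳ i))

  private
    ρσ-injective : ∀ {a b} → ρ (σ ⟨$⟩ʳ a) ≡ ρ (σ ⟨$⟩ʳ b) → a ≡ b
    ρσ-injective eq = trans (sym (Permutation.inverseˡ σ)) (trans (cong (σ ⟨$⟩ˡ_) (ρ-injective eq)) (Permutation.inverseˡ σ))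

  ρ₁-injective : Injective _≡_ _≡_ ρ₁
  ρ₁-injective eq = ↑ˡ-injective n₂ _ _ (ρσ-injective eq)

  ρ₂-injective : Injective _≡_ _≡_ ρ₂
  ρ₂-injective eq = ↑ʳ-injective n₁ _ _ (ρσ-injective eq)

  disjoint : ∀ k₁ k₂ → ρ₁ k₁ ≢ ρ₂ k₂
  disjoint k₁ k₂ eq with trans (sym (splitAt-↑ˡ n₁ k₁ n₂)) (trans (cong (splitAt n₁) (ρσ-injective eq)) (splitAt-↑ʳ n₁ n₂ k₂))
  ... | ()

  image₁ : ∀ {j} → (∃ λ k₁ → ρ₁ k₁ ≡ j) → ∃ λ k → ρ k ≡ j
  image₁ (k₁ , eq) = σ ⟨$⟩ʳ (k₁ ↑ˡ n₂) , eq

  image₂ : ∀ {j} → (∃ λ k₂ → ρ₂ k₂ ≡ j) → ∃ λ k → ρ k ≡ j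
  image₂ (k₂ , eq) = σ ⟨$⟩ʳ (n₁ ↑ʳ k₂) , eq

  cover : ∀ k → (∃ λ k₁ → ρ₁ k₁ ≡ ρ k) ⊎ (∃ λ k₂ → ρ₂ k₂ ≡ ρ k)
  cover k with splitAt n₁ (σ ⟨$⟩ˡ k) in eq
  ... | inj₁ k₁ = inj₁ (k₁ , cong ρ (trans (cong (σ ⟨$⟩ʳ_) (splitAt⁻¹-↑ˡ eq)) (Permutation.inverseʳ σ)))
  ... | inj₂ k₂ = inj₂ (k₂ , cong ρ (trans (cong (σ ⟨$⟩ʳ_) (splitAt⁻¹-↑ʳ eq)) (Permutation.inverseʳ σ)))

-- The expansion of α(Π x⁽¹⁾, …, Π x⁽ʳ⁾), carried out for a form α whose
-- n slots are assigned injectively to blocks by ρ : Fin n → Fin r.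
module ExpandForms {c ℓ : Level} (G : Group c ℓ) (r : ℕ) (m : Fin r → ℕ)
                   (x : (j : Fin r) → Fin (m j) → Group.Carrier G)
                   (default : (j : Fin r) → Fin (m j)) where
  open Group G using (Carrier; _≈_) renaming (trans to ≈-trans; sym to ≈-sym; reflexive to ≈-reflexive)
  open CommutatorIdentities G using (⁅⁆-cong)
  open CommutatorLists {Letter r m}

  value : Letter r m → Carrier
  value p = x (proj₁ p) (proj₂ p)

  block : Fin r → Carrier
  block j = prod G (m j) (x j)

  open Evaluation G value

  Choice : Set
  Choice = (j : Fin r) → Fin (m j)

  basic : ∀ {n} → CForm n → (Fin n → Fin r) → Choice → FC (Letter r m)
  basic α ρ ι = apply α (λ k → (ρ k , ι (ρ k)))

  IsBasic : ∀ {n} → CForm n → (Fin n → Fin r) → FC (Letter r m) → Set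
  IsBasic α ρ e = ∃ λ ι → e ≡ basic α ρ ι

  choose : (j₀ : Fin r) → Fin (m j₀) → Choice
  choose j₀ i j with j₀ ≟ j
  ... | yes refl = i
  ... | no _     = default j

  choose-≡ : ∀ j₀ i → choose j₀ i j₀ ≡ i
  choose-≡ j₀ i with j₀ ≟ j₀
  ... | yes refl = refl
  ... | no j₀≢j₀ = ⊥-elim (j₀≢j₀ refl)

  glue : ∀ {n} → (Fin n → Fin r) → Choice → Choice → Choice
  glue ρ₁ ι₁ ι₂ j with any? (λ k → ρ₁ k ≟ j)
  ... | yes _ = ι₁ j
  ... | no _  = ι₂ j

  glue-inside : ∀ {n} (ρ₁ : Fin n → Fin r) ι₁ ι₂ k → glue ρ₁ ι₁ ι₂ (ρ₁ k) ≡ ι₁ (ρ₁ k)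
  glue-inside ρ₁ ι₁ ι₂ k with any? (λ k′ → ρ₁ k′ ≟ ρ₁ k)
  ... | yes _     = refl
  ... | no ∉image = ⊥-elim (∉image (k , refl))

  glue-outside : ∀ {n} (ρ₁ : Fin n → Fin r) ι₁ ι₂ {j} → (∀ k → ρ₁ k ≢ j) → glue ρ₁ ι₁ ι₂ j ≡ ι₂ j
  glue-outside ρ₁ ι₁ ι₂ {j} ∉image with any? (λ k → ρ₁ k ≟ j)
  ... | yes (k , eq) = ⊥-elim (∉image k eq)
  ... | no _         = refl

  -- The extra invariant `confined`
  -- (only letters of these blocks occur) is what separates the two halves
  -- of a node and so keeps the terms of commList distinct.
  record IsExpansion {n} (α : CForm n) (ρ : Fin n → Fin r) (η : List (FC (Letter r m))) : Set ℓ where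
    field
      product  : evalFC G block (apply α ρ) ≈ Π η
      complete : ∀ ι → basic α ρ ι ∈ η
      covers   : ∀ {e} → e ∈ η → ∀ k → ∃ λ i → letter (ρ k , i) ⊑ e
      confined : ∀ {e} → e ∈ η → ∀ {z} → letter z ⊑ e → ∃ λ k → ρ k ≡ proj₁ z
      distinct : Unique η
      heavy    : ∀ {e} → e ∈ η → IsBasic α ρ e ⊎ n < weight e

  open IsExpansion

  weight-lower : ∀ {n} {α : CForm n} {ρ e} → IsBasic α ρ e ⊎ n < weight e → n ≤ weight e
  weight-lower {α = α} (inj₁ (_ , refl)) = ≤-reflexive (sym (weight-apply α _))
  weight-lower         (inj₂ n<w)        = <⇒≤ n<w

  blockLetters : Fin r → List (FC (Letter r m))
  blockLetters j = tabulate (λ i → letter (j , i))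

  blockLetters⁻ : ∀ {j e} → e ∈ blockLetters j → ∃ λ i → e ≡ letter (j , i)
  blockLetters⁻ {j} = ∈-tabulate⁻ {f = λ i → letter (j , i)}

  expand-idF : ∀ ρ → IsExpansion idF ρ (blockLetters (ρ zero))
  expand-idF ρ = record
    { product  = ≈-reflexive (prod-tabulate (m (ρ zero)) (λ i → letter (ρ zero , i)))
    ; complete = λ ι → ∈-tabulate⁺ (ι (ρ zero))
    ; covers   = covers′
    ; confined = confined′
    ; distinct = UniqueProperties.tabulate⁺ (λ { refl → refl })
    ; heavy    = heavy′
    }
    where
    covers′ : ∀ {e} → e ∈ blockLetters (ρ zero) → ∀ k → ∃ λ i → letter (ρ k , i) ⊑ e
    covers′ e∈ zero with blockLetters⁻ e∈
    ... | i , refl = i , here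
    confined′ : ∀ {e} → e ∈ blockLetters (ρ zero) → ∀ {z} → letter z ⊑ e → ∃ λ k → ρ k ≡ proj₁ z
    confined′ e∈ z⊑e with blockLetters⁻ e∈
    ... | i , refl with letter-⊑-letter z⊑e
    ...   | refl = zero , refl
    heavy′ : ∀ {e} → e ∈ blockLetters (ρ zero) → IsBasic idF ρ e ⊎ 1 < weight e
    heavy′ e∈ with blockLetters⁻ e∈
    ... | i , refl = inj₁ (choose (ρ zero) i , cong (λ i′ → letter (ρ zero , i′)) (sym (choose-≡ (ρ zero) i)))

  module NodeCase {n₁ n₂} (γ₁ : CForm n₁) (γ₂ : CForm n₂) (σ : Permutation′ (n₁ + n₂))
                  (ρ : Fin (n₁ + n₂) → Fin r) (ρ-injective : Injective _≡_ _≡_ ρ) where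
    open SlotSplit {n₁} {n₂} σ ρ ρ-injective

    basic-node : ∀ {a b} → IsBasic γ₁ ρ₁ a → IsBasic γ₂ ρ₂ b → IsBasic (node γ₁ γ₂ σ) ρ ⟦ a , b ⟧
    basic-node (ι₁ , refl) (ι₂ , refl) = glue ρ₁ ι₁ ι₂ , cong₂ ⟦_,_⟧
      (apply-cong γ₁ (λ k → cong (ρ₁ k ,_) (sym (glue-inside ρ₁ ι₁ ι₂ k))))
      (apply-cong γ₂ (λ k → cong (ρ₂ k ,_) (sym (glue-outside ρ₁ ι₁ ι₂ (λ k₁ → disjoint k₁ k)))))

    -- Letters from the blocks of γ₂ distinguish the terms of B from those of A.
    InSecond : Letter r m → Set
    InSecond z = ∃ λ k → ρ₂ k ≡ proj₁ z

    expand-node : ∀ {A B} → IsExpansion γ₁ ρ₁ A → IsExpansion γ₂ ρ₂ B → IsExpansion (node γ₁ γ₂ σ) ρ (commList A B)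
    expand-node {A} {B} EA EB = record
      { product  = ≈-trans (⁅⁆-cong (product EA) (product EB)) (≈-sym (Π-commList A B))
      ; complete = λ ι → commList-basic A B (complete EA ι) (complete EB ι)
      ; covers   = covers′
      ; confined = confined′
      ; distinct = unique-commList A B (distinct EA) (distinct EB) (All.tabulate A-unmarked) (All.tabulate B-marked)
      ; heavy    = heavy′
      }
      where
      open Separated (Mentions InSecond) mentions-⊑

      A-unmarked : ∀ {a} → a ∈ A → ¬ Mentions InSecond a
      A-unmarked a∈ (z , (k₂ , eq₂) , z⊑a) with confined EA a∈ z⊑a
      ... | k₁ , eq₁ = disjoint k₁ k₂ (trans eq₁ (sym eq₂))

      B-marked : ∀ {b} → b ∈ B → Mentions InSecond b
      B-marked b∈ with covers EB b∈ (some-slot γ₂)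
      ... | i , z⊑b = (ρ₂ (some-slot γ₂) , i) , (some-slot γ₂ , refl) , z⊑b

      covers′ : ∀ {e} → e ∈ commList A B → ∀ k → ∃ λ i → letter (ρ k , i) ⊑ e
      covers′ {e} e∈ k with commList-above A B e∈ | cover k
      ... | a , a∈ , b , b∈ , ab⊑e | inj₁ (k₁ , eq) =
        subst (λ j → ∃ λ i → letter (j , i) ⊑ e) eq (Product.map₂ (λ z⊑a → ⊑-trans (left z⊑a) ab⊑e) (covers EA a∈ k₁))
      ... | a , a∈ , b , b∈ , ab⊑e | inj₂ (k₂ , eq) =
        subst (λ j → ∃ λ i → letter (j , i) ⊑ e) eq (Product.map₂ (λ z⊑b → ⊑-trans (right z⊑b) ab⊑e) (covers EB b∈ k₂))

      confined′ : ∀ {e} → e ∈ commList A B → ∀ {z} → letter z ⊑ e → ∃ λ k → ρ k ≡ proj₁ z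
      confined′ e∈ z⊑e with commList-letters A B e∈ z⊑e
      ... | s , inj₁ s∈A , z⊑s = image₁ (confined EA s∈A z⊑s)
      ... | s , inj₂ s∈B , z⊑s = image₂ (confined EB s∈B z⊑s)

      heavy′ : ∀ {e} → e ∈ commList A B → IsBasic (node γ₁ γ₂ σ) ρ e ⊎ n₁ + n₂ < weight e
      heavy′ e∈ with commList-weight A B e∈
      ... | a , a∈ , b , b∈ , inj₂ heavier =
        inj₂ (≤-<-trans (+-mono-≤ (weight-lower (heavy EA a∈)) (weight-lower (heavy EB b∈))) heavier)
      ... | a , a∈ , b , b∈ , inj₁ refl with heavy EA a∈ | heavy EB b∈
      ...   | inj₁ a-basic | inj₁ b-basic = inj₁ (basic-node a-basic b-basic)
      ...   | inj₂ a-heavy | b-weight     = inj₂ (+-mono-<-≤ a-heavy (weight-lower b-weight))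
      ...   | inj₁ a-basic | inj₂ b-heavy = inj₂ (+-mono-≤-< (weight-lower {α = γ₁} (inj₁ a-basic)) b-heavy)

  expand : ∀ {n} (α : CForm n) (ρ : Fin n → Fin r) → Injective _≡_ _≡_ ρ → Σ (List (FC (Letter r m))) (IsExpansion α ρ)
  expand idF            ρ _     = _ , expand-idF ρ
  expand (node {n₁} {n₂} γ₁ γ₂ σ) ρ ρ-inj = _ , NodeCase.expand-node γ₁ γ₂ σ ρ ρ-inj (proj₂ (expand γ₁ ρ₁ ρ₁-injective))
                                                                            (proj₂ (expand γ₂ ρ₂ ρ₂-injective))
    where open SlotSplit {n₁} {n₂} σ ρ ρ-inj

lookup-injective : ∀ {A : Set} {xs : List A} → Unique xs → ∀ i j → lookup xs i ≡ lookup xs j → i ≡ j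
lookup-injective (_ ∷ _)   zero    zero    _  = refl
lookup-injective (x∉ ∷ _)  zero    (suc j) eq = ⊥-elim (All.lookup x∉ (∈-lookup j) eq)
lookup-injective (x∉ ∷ _)  (suc i) zero    eq = ⊥-elim (All.lookup x∉ (∈-lookup i) (sym eq))
lookup-injective (_ ∷ xs!) (suc i) (suc j) eq = cong suc (lookup-injective xs! i j eq)

propositionB2 : ∀ {c ℓ : Level} (G : Group c ℓ) → IsNilpotent G →
    (r : ℕ) → 1 ≤ r → (m : Fin r → ℕ) → (∀ j → 1 ≤ m j) →
    (x : (j : Fin r) → Fin (m j) → Group.Carrier G) → (α : CForm r) →
    Σ ℕ λ t → Σ (Fin t → FC (Letter r m)) λ η →
      Group._≈_ G (evalFC G (λ j → prod G (m j) (x j)) (apply α (λ j → j)))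
                  (prod G t (λ l → evalFC G (λ p → x (proj₁ p) (proj₂ p)) (η l)))
      × (∀ (ι : (j : Fin r) → Fin (m j)) → ∃ λ l → η l ≡ apply α (λ j → (j , ι j)))
      × (∀ (l : Fin t) (j : Fin r) → ∃ λ (i : Fin (m j)) → letter (j , i) ⊑ η l)
      × (∀ (l l′ : Fin t) → η l ≡ η l′ → l ≡ l′)
      × (∀ (l : Fin t) → ¬ (∃ λ (ι : (j : Fin r) → Fin (m j)) → η l ≡ apply α (λ j → (j , ι j))) → r < weight (η l))
propositionB2 G _ r _ m m≥1 x α =
    length η , lookup η
  , Group.trans G product (Group.reflexive G (sym (prod-lookup η)))
  , (λ ι → index (complete ι) , sym (lookup-index (complete ι)))
  , (λ l → covers (∈-lookup l))
  , lookup-injective distinct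
  , (λ l not-basic → Sum.fromInj₂ (⊥-elim ∘ not-basic) (heavy (∈-lookup l)))
  where
  open ExpandForms G r m x (λ j → fromℕ< (m≥1 j))
  open Evaluation G value using (prod-lookup)

  expansion : Σ (List (FC (Letter r m))) (IsExpansion α (λ j → j))
  expansion = expand α (λ j → j) (λ eq → eq)

  η : List (FC (Letter r m))
  η = proj₁ expansion

  open IsExpansion (proj₂ expansion)
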